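{- Let $k\ge1$ and $n\ge1$. Let $\tau$ be a $(k+1)$-bundled increasing tree of order $n$ and $\sigma=\Psi(\tau)$ the associated $k$-bundled Stirling permutation (via the bijection $\Psi$ described in the context). Then the number of ascents of $\sigma$ equals $B_A(\tau)$, the number of descents of $\sigma$ equals $B_D(\tau)$, and the number of plateaux of $\sigma$ equals $B_E(\tau)$.
   Context: A $k$-bundled Stirling permutation of order $n$ is a permutation $a_1\cdots a_\ell$ ($\ell=k+(k+2)(n-1)$) of the multiset $\{1^k,2^{k+2},\dots,n^{k+2}\}$ such that for each $i$ every entry between two occurrences of $i$ is at least $i$. With $a_0=a_{\ell+1}=0$, an index $i\in\{0,\dots,\ell\}$ is an ascent if $a_i<a_{i+1}$, a descent if $a_i>a_{i+1}$, a plateau if $a_i=a_{i+1}$. A $(k+1)$-bundled increasing tree of order $n$ is a rooted tree with vertex set $\{1,\dots,n\}$, root $1$, labels increasing along paths away from the root, in which every vertex has $k+1$ ordered bundles, each containing a (possibly empty) linearly ordered sequence of children; each non-root vertex lies in exactly one bundle of its parent. The bijection $\Psi$: for a non-root vertex $v$ with bundles whose subtree sequences are $(T_{i,1},\dots,T_{i,m_i})$, $i=1,\dots,k+1$, let $C_i=\mathrm{code}(T_{i,1})\cdots\mathrm{code}(T_{i,m_i})$ and $\mathrm{code}(\text{subtree at }v)=v\,C_1\,v\,C_2\,v\cdots v\,C_{k+1}\,v$ ($k+2$ copies of $v$). For the root, $\Psi(\tau)=C_1\,1\,C_2\,1\cdots1\,C_{k+1}$ ($k$ copies of $1$). This is a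 bijection onto $k$-bundled Stirling permutations of order $n$. Parameters: an ascent in a bundle is a pair of consecutive subtrees in the same bundle where the root of the left one is smaller than the root of the right one; a descent in a bundle is such a pair where the left root is larger. $B_A(\tau)$ = (number of ascents in bundles over all vertices) + (number of non-empty bundles over all vertices) + ($1$ if the first bundle of the root is empty, else $0$). $B_D(\tau)$ = (number of descents in bundles over all vertices) + (number of non-empty bundles) + ($1$ if the last bundle of the root is empty, else $0$). $B_E(\tau)$ = (number of empty bundles of vertices with label larger than $1$) + (number of empty bundles of the root among bundles $2,\dots,k$). -}

module Defs where

open import Data.Nat using (ℕ; zero; suc; _+_; _<_; _<ᵇ_; _≡ᵇ_)
open import Data.Bool using (Bool; true; false; if_then_else_)
open import Data.List using (List; []; _∷_; _++_; [_]; map; upTo)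
open import Data.Vec using (Vec; []; _∷_)
open import Data.Product using (_×_)
open import Data.Unit using (⊤)
open import Relation.Binary.PropositionalEquality using (_≡_)
open import Data.List.Relation.Binary.Permutation.Propositional using (_↭_)

-- Bundled plane trees: a vertex carries a label and b ordered bundles,
-- each bundle being a linearly ordered (possibly empty) list of subtrees.

data Tree (b : ℕ) : Set where
  node : ℕ → Vec (List (Tree b)) b → Tree b

label : ∀ {b} → Tree b → ℕ
label (node v _) = v

mutual
  labels : ∀ {b} → Tree b → List ℕ
  labels (node v bs) = v ∷ labelsBundles bs

  labelsBundles : ∀ {b m} → Vec (List (Tree b)) m → List ℕ
  labelsBundles [] = []
  labelsBundles (f ∷ bs) = labelsForest f ++ labelsBundles bs

  labelsForest : ∀ {b} → List (Tree b) → List ℕ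
  labelsForest [] = []
  labelsForest (t ∷ ts) = labels t ++ labelsForest ts

mutual
  Increasing : ∀ {b} → Tree b → Set
  Increasing (node v bs) = IncBundles v bs

  IncBundles : ∀ {b m} → ℕ → Vec (List (Tree b)) m → Set
  IncBundles v [] = ⊤
  IncBundles v (f ∷ bs) = IncForest v f × IncBundles v bs

  IncForest : ∀ {b} → ℕ → List (Tree b) → Set
  IncForest v [] = ⊤
  IncForest v (t ∷ ts) = (v < label t) × Increasing t × IncForest v ts

-- τ is a (k+1)-bundled increasing tree of order n:
-- every vertex has k+1 bundles (built into the type Tree (suc k)),
-- root is 1, labels increase away from the root, vertex set is {1,…,n}.
IsBundledIncreasingTree : (k n : ℕ) → Tree (suc k) → Set
IsBundledIncreasingTree k n τ =
  (label τ ≡ 1) × Increasing τ × (labels τ ↭ map suc (upTo n))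

mutual
  -- code of a non-root subtree: v C₁ v C₂ v ⋯ v C_{k+1} v
  code : ∀ {b} → Tree b → List ℕ
  code (node v bs) = v ∷ codeBundles v bs

  codeBundles : ∀ {b m} → ℕ → Vec (List (Tree b)) m → List ℕ
  codeBundles v [] = []
  codeBundles v (f ∷ bs) = codeForest f ++ (v ∷ codeBundles v bs)

  codeForest : ∀ {b} → List (Tree b) → List ℕ
  codeForest [] = []
  codeForest (t ∷ ts) = code t ++ codeForest ts

rootRest : ∀ {b m} → ℕ → Vec (List (Tree b)) m → List ℕ
rootRest r [] = []
rootRest r (f ∷ bs) = r ∷ (codeForest f ++ rootRest r bs)

-- Ψ(τ) = C₁ 1 C₂ 1 ⋯ 1 C_{k+1}
Ψ : ∀ {k} → Tree (suc k) → List ℕ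
Ψ (node r (f ∷ bs)) = codeForest f ++ rootRest r bs

countAdj : (ℕ → ℕ → Bool) → List ℕ → ℕ
countAdj R [] = 0
countAdj R (x ∷ []) = 0
countAdj R (x ∷ y ∷ ys) = (if R x y then 1 else 0) + countAdj R (y ∷ ys)

padded : List ℕ → List ℕ
padded σ = 0 ∷ (σ ++ [ 0 ])

asc : List ℕ → ℕ
asc σ = countAdj (λ x y → x <ᵇ y) (padded σ)

des : List ℕ → ℕ
des σ = countAdj (λ x y → y <ᵇ x) (padded σ)

plat : List ℕ → ℕ
plat σ = countAdj (λ x y → x ≡ᵇ y) (padded σ)

boolℕ : Bool → ℕ
boolℕ true = 1
boolℕ false = 0

isEmpty : ∀ {A : Set} → List A → Bool
isEmpty [] = true
isEmpty (_ ∷ _) = false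

nonEmpty : ∀ {A : Set} → List A → Bool
nonEmpty [] = false
nonEmpty (_ ∷ _) = true

bundlePairs : ∀ {b} → (ℕ → ℕ → Bool) → List (Tree b) → ℕ
bundlePairs R ts = countAdj R (map label ts)

mutual
  sumT : ∀ {b} → (ℕ → Vec (List (Tree b)) b → ℕ) → Tree b → ℕ
  sumT g (node v bs) = g v bs + sumBundles g bs

  sumBundles : ∀ {b m} → (ℕ → Vec (List (Tree b)) b → ℕ) → Vec (List (Tree b)) m → ℕ
  sumBundles g [] = 0
  sumBundles g (f ∷ bs) = sumForest g f + sumBundles g bs

  sumForest : ∀ {b} → (ℕ → Vec (List (Tree b)) b → ℕ) → List (Tree b) → ℕ
  sumForest g [] = 0
  sumForest g (t ∷ ts) = sumT g t + sumForest g ts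

sumVec : ∀ {A : Set} {m} → (A → ℕ) → Vec A m → ℕ
sumVec h [] = 0
sumVec h (x ∷ xs) = h x + sumVec h xs

ascInBundles : ∀ {b} → Tree b → ℕ
ascInBundles = sumT (λ _ bs → sumVec (bundlePairs (λ x y → x <ᵇ y)) bs)

desInBundles : ∀ {b} → Tree b → ℕ
desInBundles = sumT (λ _ bs → sumVec (bundlePairs (λ x y → y <ᵇ x)) bs)

nonEmptyBundles : ∀ {b} → Tree b → ℕ
nonEmptyBundles = sumT (λ _ bs → sumVec (λ f → boolℕ (nonEmpty f)) bs)

emptyBundlesAbove1 : ∀ {b} → Tree b → ℕ
emptyBundlesAbove1 = sumT (λ v bs → if 1 <ᵇ v then sumVec (λ f → boolℕ (isEmpty f)) bs else 0)

firstBundle : ∀ {k} → Tree (suc k) → List (Tree (suc k))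
firstBundle (node _ (f ∷ _)) = f

lastBundle : ∀ {k} → Tree (suc k) → List (Tree (suc k))
lastBundle (node _ bs) = Data.Vec.last bs

emptyMiddle : ∀ {A : Set} {k} → Vec (List A) (suc k) → ℕ
emptyMiddle {k = zero} (f ∷ []) = 0
emptyMiddle {k = suc k} (f ∷ bs) = sumVec (λ g → boolℕ (isEmpty g)) (Data.Vec.init bs)

rootMiddleEmpty : ∀ {k} → Tree (suc k) → ℕ
rootMiddleEmpty (node _ bs) = emptyMiddle bs

B-A : ∀ {k} → Tree (suc k) → ℕ
B-A τ = ascInBundles τ + nonEmptyBundles τ + boolℕ (isEmpty (firstBundle τ))

B-D : ∀ {k} → Tree (suc k) → ℕ
B-D τ = desInBundles τ + nonEmptyBundles τ + boolℕ (isEmpty (lastBundle τ))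

B-E : ∀ {k} → Tree (suc k) → ℕ
B-E τ = emptyBundlesAbove1 τ + rootMiddleEmpty τ

module Submission where

-- The padded word 0 σ 0 is a concatenation of codes of subtrees separated
-- by copies of vertex labels, and every code begins and ends with the root
-- of its subtree.  Hence the adjacent pairs of the padded word split over
-- the bundles of all vertices: a bundle with subtree roots r₁ … rₘ whose
-- delimiting letters are p and q contributes the pairs of the word
-- p r₁ … rₘ q.  For a non-root vertex v both delimiters are v; the root's
-- bundles are delimited by (0,1), (1,1), …, (1,1), (1,0) because of the
-- padding.  This decomposition (frame, code-count, Ψ-count) holds for an
-- arbitrary Boolean relation R on adjacent letters.
--
-- If R only depends on the order of its two arguments and the roots of
-- the bundle exceed both delimiters (increasing labels), the bundle
-- contributes its R-pairs between consecutive roots plus a constant that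
-- only depends on whether the bundle is empty (bundleCount-sep).  Taking
-- R to be <, > and = gives per-bundle counts; summing them over the tree
-- (sumBundles-agree, sumT-+) yields B-A, B-D and B-E.  For plateaux we
-- also need distinct sibling labels, which holds because the labels form
-- a permutation of 1 … n.

open import Defs
open import Data.Nat using (ℕ; suc; _≤_; _<_; _+_; _<ᵇ_; _≡ᵇ_; s≤s; z≤n)
open import Data.Nat.Properties
  using (+-assoc; +-comm; +-commutativeSemigroup; ≤-refl; ≤-trans; <⇒≤; <⇒≢; <-irrefl; <-asym;
         <ᵇ⇒<; <⇒<ᵇ; ≡ᵇ⇒≡; ≡⇒≡ᵇ; suc-injective)
open import Algebra.Properties.CommutativeSemigroup +-commutativeSemigroup using (interchange)
open import Data.Nat.Tactic.RingSolver using (solve-∀)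
open import Data.Bool using (Bool; true; false; if_then_else_; T)
open import Data.List using (List; []; _∷_; _++_; [_]; map; upTo)
open import Data.List.Properties using (++-assoc)
open import Data.Vec using (Vec; []; _∷_; init; last)
open import Data.Product using (_×_; _,_)
open import Data.Unit using (tt)
open import Data.Empty using (⊥-elim)
open import Relation.Nullary using (¬_)
open import Relation.Binary.PropositionalEquality
  using (_≡_; _≢_; refl; sym; trans; cong; cong₂; setoid; module ≡-Reasoning)
open import Data.List.Relation.Unary.All as All using (All; []; _∷_)
import Data.List.Relation.Unary.All.Properties as All
open import Data.List.Relation.Unary.AllPairs using ([]; _∷_)
open import Data.List.Relation.Unary.Unique.Propositional using (Unique)
import Data.List.Relation.Unary.Unique.Propositional.Properties as Unique
open import Data.List.Relation.Binary.Permutation.Propositional using (_↭_; ↭-sym; ↭⇒↭ₛ)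
open import Data.List.Relation.Binary.Permutation.Setoid.Properties (setoid ℕ)
  using (Unique-resp-↭)

open ≡-Reasoning

indicator : Bool → ℕ
indicator b = if b then 1 else 0

lastOr : ℕ → List ℕ → ℕ
lastOr p [] = p
lastOr p (x ∷ xs) = lastOr x xs

lastOr-++ : ∀ p xs ys → lastOr p (xs ++ ys) ≡ lastOr (lastOr p xs) ys
lastOr-++ p [] ys = refl
lastOr-++ p (x ∷ xs) ys = lastOr-++ x xs ys

All-lastOr : ∀ {P : ℕ → Set} {p} xs → All P (p ∷ xs) → P (lastOr p xs)
All-lastOr [] (pp ∷ []) = pp
All-lastOr (x ∷ xs) (_ ∷ pxs) = All-lastOr xs pxs

countAdj-++ : ∀ R p xs ys →
  countAdj R (p ∷ xs ++ ys) ≡ countAdj R (p ∷ xs) + countAdj R (lastOr p xs ∷ ys)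
countAdj-++ R p [] ys = refl
countAdj-++ R p (x ∷ xs) ys =
  trans (cong (indicator (R p x) +_) (countAdj-++ R x xs ys))
        (sym (+-assoc (indicator (R p x)) _ _))

bundleCount : ∀ {b} → (ℕ → ℕ → Bool) → ℕ → ℕ → List (Tree b) → ℕ
bundleCount R p q f = countAdj R (p ∷ map label f) + indicator (R (lastOr p (map label f)) q)

-- contribution of a non-root vertex v: all its bundles are delimited by v
localCount : ∀ {b} → (ℕ → ℕ → Bool) → ℕ → Vec (List (Tree b)) b → ℕ
localCount R v bs = sumVec (bundleCount R v v) bs

codeBundles-last : ∀ {b m} v (bs : Vec (List (Tree b)) m) → lastOr v (codeBundles v bs) ≡ v
codeBundles-last v [] = refl
codeBundles-last v (f ∷ bs) =
  trans (lastOr-++ v (codeForest f) (v ∷ codeBundles v bs)) (codeBundles-last v bs)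

code-last : ∀ {b} p (t : Tree b) → lastOr p (code t) ≡ label t
code-last p (node v bs) = codeBundles-last v bs

codeForest-last : ∀ {b} p (ts : List (Tree b)) → lastOr p (codeForest ts) ≡ lastOr p (map label ts)
codeForest-last p [] = refl
codeForest-last p (t ∷ ts) = begin
  lastOr p (code t ++ codeForest ts)       ≡⟨ lastOr-++ p (code t) (codeForest ts) ⟩
  lastOr (lastOr p (code t)) (codeForest ts) ≡⟨ cong (λ z → lastOr z (codeForest ts)) (code-last p t) ⟩
  lastOr (label t) (codeForest ts)         ≡⟨ codeForest-last (label t) ts ⟩
  lastOr (label t) (map label ts)          ∎

reassoc-frame : ∀ c s i r → (c + s) + (i + r) ≡ ((c + i) + s) + r
reassoc-frame = solve-∀

mutual
  code-count : ∀ {b} R p (t : Tree b) →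
    countAdj R (p ∷ code t) ≡ indicator (R p (label t)) + sumT (localCount R) t
  code-count R p (node v bs) = cong (indicator (R p v) +_) (codeBundles-count R v bs)

  codeBundles-count : ∀ {b m} R v (bs : Vec (List (Tree b)) m) →
    countAdj R (v ∷ codeBundles v bs) ≡ sumVec (bundleCount R v v) bs + sumBundles (localCount R) bs
  codeBundles-count R v [] = refl
  codeBundles-count R v (f ∷ bs) = begin
    countAdj R (v ∷ codeForest f ++ v ∷ codeBundles v bs)
      ≡⟨ frame R v v f (codeBundles v bs) ⟩
    (bundleCount R v v f + sumForest (localCount R) f) + countAdj R (v ∷ codeBundles v bs)
      ≡⟨ cong (_ +_) (codeBundles-count R v bs) ⟩
    (bundleCount R v v f + sumForest (localCount R) f)
      + (sumVec (bundleCount R v v) bs + sumBundles (localCount R) bs)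
      ≡⟨ interchange (bundleCount R v v f) _ _ _ ⟩
    (bundleCount R v v f + sumVec (bundleCount R v v) bs)
      + (sumForest (localCount R) f + sumBundles (localCount R) bs)
      ∎

  codeForest-count : ∀ {b} R p (ts : List (Tree b)) →
    countAdj R (p ∷ codeForest ts) ≡ countAdj R (p ∷ map label ts) + sumForest (localCount R) ts
  codeForest-count R p [] = refl
  codeForest-count R p (t ∷ ts) = begin
    countAdj R (p ∷ code t ++ codeForest ts)
      ≡⟨ countAdj-++ R p (code t) (codeForest ts) ⟩
    countAdj R (p ∷ code t) + countAdj R (lastOr p (code t) ∷ codeForest ts)
      ≡⟨ cong₂ _+_ (code-count R p t) (cong (λ z → countAdj R (z ∷ codeForest ts)) (code-last p t)) ⟩
    (indicator (R p (label t)) + sumT (localCount R) t) + countAdj R (label t ∷ codeForest ts)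
      ≡⟨ cong (_ +_) (codeForest-count R (label t) ts) ⟩
    (indicator (R p (label t)) + sumT (localCount R) t)
      + (countAdj R (label t ∷ map label ts) + sumForest (localCount R) ts)
      ≡⟨ interchange (indicator (R p (label t))) _ _ _ ⟩
    (indicator (R p (label t)) + countAdj R (label t ∷ map label ts))
      + (sumT (localCount R) t + sumForest (localCount R) ts)
      ∎

  frame : ∀ {b} R p q (f : List (Tree b)) ys →
    countAdj R (p ∷ codeForest f ++ q ∷ ys)
      ≡ (bundleCount R p q f + sumForest (localCount R) f) + countAdj R (q ∷ ys)
  frame R p q f ys = begin
    countAdj R (p ∷ codeForest f ++ q ∷ ys)
      ≡⟨ countAdj-++ R p (codeForest f) (q ∷ ys) ⟩
    countAdj R (p ∷ codeForest f) + countAdj R (lastOr p (codeForest f) ∷ q ∷ ys)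
      ≡⟨ cong₂ _+_ (codeForest-count R p f)
                   (cong (λ z → countAdj R (z ∷ q ∷ ys)) (codeForest-last p f)) ⟩
    (countAdj R (p ∷ map label f) + sumForest (localCount R) f)
      + (indicator (R (lastOr p (map label f)) q) + countAdj R (q ∷ ys))
      ≡⟨ reassoc-frame (countAdj R (p ∷ map label f)) _ _ _ ⟩
    (bundleCount R p q f + sumForest (localCount R) f) + countAdj R (q ∷ ys)
      ∎

-- contributions of the root bundles 2, …, k+1: delimited by 1 and 1,
-- except the last one, which is closed by the padding letter 0
tailCount : ∀ {b m} → (ℕ → ℕ → Bool) → Vec (List (Tree b)) (suc m) → ℕ
tailCount R (f ∷ []) = bundleCount R 1 0 f
tailCount R (f ∷ g ∷ fs) = bundleCount R 1 1 f + tailCount R (g ∷ fs)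

rootTail-count : ∀ {b m} R (bs : Vec (List (Tree b)) (suc m)) →
  countAdj R (rootRest 1 bs ++ [ 0 ]) ≡ tailCount R bs + sumBundles (localCount R) bs
rootTail-count R (f ∷ fs) =
  trans (cong (λ w → countAdj R (1 ∷ w)) (++-assoc (codeForest f) (rootRest 1 fs) [ 0 ])) (rest fs)
  where
  rest : ∀ {m} (fs : Vec _ m) →
    countAdj R (1 ∷ codeForest f ++ rootRest 1 fs ++ [ 0 ])
      ≡ tailCount R (f ∷ fs) + sumBundles (localCount R) (f ∷ fs)
  rest [] = trans (frame R 1 0 f []) (+-assoc (bundleCount R 1 0 f) _ 0)
  rest (g ∷ gs) = begin
    countAdj R (1 ∷ codeForest f ++ rootRest 1 (g ∷ gs) ++ [ 0 ])
      ≡⟨ frame R 1 1 f _ ⟩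
    (bundleCount R 1 1 f + sumForest (localCount R) f) + countAdj R (rootRest 1 (g ∷ gs) ++ [ 0 ])
      ≡⟨ cong (_ +_) (rootTail-count R (g ∷ gs)) ⟩
    (bundleCount R 1 1 f + sumForest (localCount R) f)
      + (tailCount R (g ∷ gs) + sumBundles (localCount R) (g ∷ gs))
      ≡⟨ interchange (bundleCount R 1 1 f) _ _ _ ⟩
    tailCount R (f ∷ g ∷ gs) + sumBundles (localCount R) (f ∷ g ∷ gs)
      ∎

Ψ-count : ∀ {k} R (f : List (Tree (suc (suc k)))) bs →
  countAdj R (padded (Ψ (node 1 (f ∷ bs))))
    ≡ (bundleCount R 0 1 f + tailCount R bs) + sumBundles (localCount R) (f ∷ bs)
Ψ-count R f (g ∷ gs) = begin
  countAdj R (0 ∷ (codeForest f ++ rootRest 1 (g ∷ gs)) ++ [ 0 ])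
    ≡⟨ cong (λ w → countAdj R (0 ∷ w)) (++-assoc (codeForest f) (rootRest 1 (g ∷ gs)) [ 0 ]) ⟩
  countAdj R (0 ∷ codeForest f ++ rootRest 1 (g ∷ gs) ++ [ 0 ])
    ≡⟨ frame R 0 1 f _ ⟩
  (bundleCount R 0 1 f + sumForest (localCount R) f) + countAdj R (rootRest 1 (g ∷ gs) ++ [ 0 ])
    ≡⟨ cong (_ +_) (rootTail-count R (g ∷ gs)) ⟩
  (bundleCount R 0 1 f + sumForest (localCount R) f)
    + (tailCount R (g ∷ gs) + sumBundles (localCount R) (g ∷ gs))
    ≡⟨ interchange (bundleCount R 0 1 f) _ _ _ ⟩
  (bundleCount R 0 1 f + tailCount R (g ∷ gs)) + sumBundles (localCount R) (f ∷ g ∷ gs)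
    ∎

record OrderDetermined (R : ℕ → ℕ → Bool) (α γ β : ℕ) : Set where
  field
    below : ∀ {x y} → x < y → indicator (R x y) ≡ α
    equal : ∀ x → indicator (R x x) ≡ γ
    above : ∀ {x y} → y < x → indicator (R x y) ≡ β

indicator-true : ∀ {b} → T b → indicator b ≡ 1
indicator-true {true} _ = refl

indicator-false : ∀ {b} → ¬ T b → indicator b ≡ 0
indicator-false {false} _ = refl
indicator-false {true} ¬t = ⊥-elim (¬t tt)

Asc Des Eq : ℕ → ℕ → Bool
Asc x y = x <ᵇ y
Des x y = y <ᵇ x
Eq x y = x ≡ᵇ y

asc-determined : OrderDetermined Asc 1 0 0
asc-determined = record
  { below = λ x<y → indicator-true (<⇒<ᵇ x<y)
  ; equal = λ x → indicator-false (λ t → <-irrefl refl (<ᵇ⇒< x x t))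
  ; above = λ {x} {y} y<x → indicator-false (λ t → <-asym y<x (<ᵇ⇒< x y t))
  }

des-determined : OrderDetermined Des 0 0 1
des-determined = record
  { below = λ {x} {y} x<y → indicator-false (λ t → <-asym x<y (<ᵇ⇒< y x t))
  ; equal = λ x → indicator-false (λ t → <-irrefl refl (<ᵇ⇒< x x t))
  ; above = λ y<x → indicator-true (<⇒<ᵇ y<x)
  }

eq-determined : OrderDetermined Eq 0 1 0
eq-determined = record
  { below = λ {x} {y} x<y → indicator-false (λ t → <⇒≢ x<y (≡ᵇ⇒≡ x y t))
  ; equal = λ x → indicator-true (≡⇒≡ᵇ x x refl)
  ; above = λ {x} {y} y<x → indicator-false (λ t → <⇒≢ y<x (sym (≡ᵇ⇒≡ x y t)))
  }

-- e for an empty bundle (its delimiters are adjacent), n otherwise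
boundary : ∀ {A : Set} → ℕ → ℕ → List A → ℕ
boundary e n [] = e
boundary e n (_ ∷ _) = n

swap-ends : ∀ a m c → (a + m) + c ≡ m + (a + c)
swap-ends = solve-∀

-- when the roots of f exceed both delimiters, the entry pair (p, r₁) and the
-- exit pair (rₘ, q) are an ascent and a descent of the order
bundleCount-sep : ∀ {b R α γ β p q} → OrderDetermined R α γ β → (f : List (Tree b)) →
  All (p <_) (map label f) → All (q <_) (map label f) →
  bundleCount R p q f ≡ bundlePairs R f + boundary (indicator (R p q)) (α + β) f
bundleCount-sep od [] _ _ = refl
bundleCount-sep {R = R} {α} {β = β} {p} {q} od (t ∷ ts) (p<t ∷ _) q<roots = begin
  (indicator (R p (label t)) + bundlePairs R (t ∷ ts))
    + indicator (R (lastOr (label t) (map label ts)) q)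
    ≡⟨ cong₂ (λ a c → (a + bundlePairs R (t ∷ ts)) + c)
             (OrderDetermined.below od p<t)
             (OrderDetermined.above od (All-lastOr (map label ts) q<roots)) ⟩
  (α + bundlePairs R (t ∷ ts)) + β
    ≡⟨ swap-ends α _ β ⟩
  bundlePairs R (t ∷ ts) + (α + β)
    ∎

nonEmptyℕ emptyℕ : ∀ {A : Set} → List A → ℕ
nonEmptyℕ f = boolℕ (nonEmpty f)
emptyℕ f = boolℕ (isEmpty f)

boundary-nonEmpty : ∀ {A : Set} (f : List A) → boundary 0 1 f ≡ nonEmptyℕ f
boundary-nonEmpty [] = refl
boundary-nonEmpty (_ ∷ _) = refl

boundary-empty : ∀ {A : Set} (f : List A) → boundary 1 0 f ≡ emptyℕ f
boundary-empty [] = refl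
boundary-empty (_ ∷ _) = refl

boundary-both : ∀ {A : Set} (f : List A) → boundary 1 1 f ≡ nonEmptyℕ f + emptyℕ f
boundary-both [] = refl
boundary-both (_ ∷ _) = refl

boundary-none : ∀ {A : Set} (f : List A) → boundary 0 0 f ≡ 0
boundary-none [] = refl
boundary-none (_ ∷ _) = refl

bundleAbove : ∀ {b p v} (f : List (Tree b)) → p ≤ v → IncForest v f → All (p <_) (map label f)
bundleAbove [] _ _ = []
bundleAbove (t ∷ ts) p≤v (v<t , _ , inc) = ≤-trans (s≤s p≤v) v<t ∷ bundleAbove ts p≤v inc

unique-++ˡ : ∀ (xs : List ℕ) {ys} → Unique (xs ++ ys) → Unique xs
unique-++ˡ [] _ = []
unique-++ˡ (x ∷ xs) (x∉ ∷ u) = All.++⁻ˡ xs x∉ ∷ unique-++ˡ xs u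

unique-++ʳ : ∀ (xs : List ℕ) {ys} → Unique (xs ++ ys) → Unique ys
unique-++ʳ [] u = u
unique-++ʳ (x ∷ xs) (_ ∷ u) = unique-++ʳ xs u

siblings-distinct : ∀ {b} (f : List (Tree b)) → Unique (labelsForest f) → bundlePairs Eq f ≡ 0
siblings-distinct [] _ = refl
siblings-distinct (_ ∷ []) _ = refl
siblings-distinct (node v bs ∷ node w cs ∷ ts) (v∉ ∷ u) =
  cong₂ _+_ (indicator-false (λ t → v≢w (≡ᵇ⇒≡ v w t)))
            (siblings-distinct (node w cs ∷ ts) (unique-++ʳ (labelsBundles bs) u))
  where v≢w = All.head (All.++⁻ʳ (labelsBundles bs) v∉)

vertexBundle : ∀ {b R α γ β} → OrderDetermined R α γ β → ∀ v (f : List (Tree b)) → IncForest v f →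
  bundleCount R v v f ≡ bundlePairs R f + boundary γ (α + β) f
vertexBundle {R = R} {α} {β = β} od v f inc =
  trans (bundleCount-sep od f above above)
        (cong (λ e → bundlePairs R f + boundary e (α + β) f) (OrderDetermined.equal od v))
  where above = bundleAbove f ≤-refl inc

vertexBundle-asc : ∀ {b} v {f : List (Tree b)} → IncForest v f →
  bundleCount Asc v v f ≡ bundlePairs Asc f + nonEmptyℕ f
vertexBundle-asc v {f} inc =
  trans (vertexBundle asc-determined v f inc) (cong (bundlePairs Asc f +_) (boundary-nonEmpty f))

vertexBundle-des : ∀ {b} v {f : List (Tree b)} → IncForest v f →
  bundleCount Des v v f ≡ bundlePairs Des f + nonEmptyℕ f
vertexBundle-des v {f} inc =
  trans (vertexBundle des-determined v f inc) (cong (bundlePairs Des f +_) (boundary-nonEmpty f))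

vertexBundle-eq : ∀ {b} v (f : List (Tree b)) → IncForest v f → Unique (labelsForest f) →
  bundleCount Eq v v f ≡ emptyℕ f
vertexBundle-eq v f inc u =
  trans (vertexBundle eq-determined v f inc) (cong₂ _+_ (siblings-distinct f u) (boundary-empty f))

firstBundle-asc : ∀ {b} (f : List (Tree b)) → IncForest 1 f →
  bundleCount Asc 0 1 f ≡ bundlePairs Asc f + (nonEmptyℕ f + emptyℕ f)
firstBundle-asc f inc =
  trans (bundleCount-sep asc-determined f (bundleAbove f z≤n inc) (bundleAbove f ≤-refl inc))
        (cong (bundlePairs Asc f +_) (boundary-both f))

lastBundle-asc : ∀ {b} (f : List (Tree b)) → IncForest 1 f →
  bundleCount Asc 1 0 f ≡ bundlePairs Asc f + nonEmptyℕ f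
lastBundle-asc f inc =
  trans (bundleCount-sep asc-determined f (bundleAbove f ≤-refl inc) (bundleAbove f z≤n inc))
        (cong (bundlePairs Asc f +_) (boundary-nonEmpty f))

firstBundle-des : ∀ {b} (f : List (Tree b)) → IncForest 1 f →
  bundleCount Des 0 1 f ≡ bundlePairs Des f + nonEmptyℕ f
firstBundle-des f inc =
  trans (bundleCount-sep des-determined f (bundleAbove f z≤n inc) (bundleAbove f ≤-refl inc))
        (cong (bundlePairs Des f +_) (boundary-nonEmpty f))

lastBundle-des : ∀ {b} (f : List (Tree b)) → IncForest 1 f →
  bundleCount Des 1 0 f ≡ bundlePairs Des f + (nonEmptyℕ f + emptyℕ f)
lastBundle-des f inc =
  trans (bundleCount-sep des-determined f (bundleAbove f ≤-refl inc) (bundleAbove f z≤n inc))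
        (cong (bundlePairs Des f +_) (boundary-both f))

outerBundle-eq : ∀ {b p q} → p ≤ 1 → q ≤ 1 → p ≢ q → (f : List (Tree b)) →
  IncForest 1 f → Unique (labelsForest f) → bundleCount Eq p q f ≡ 0
outerBundle-eq {p = p} {q} p≤1 q≤1 p≢q f inc u = begin
  bundleCount Eq p q f
    ≡⟨ bundleCount-sep eq-determined f (bundleAbove f p≤1 inc) (bundleAbove f q≤1 inc) ⟩
  bundlePairs Eq f + boundary (indicator (Eq p q)) 0 f
    ≡⟨ cong₂ (λ a e → a + boundary e 0 f) (siblings-distinct f u)
             (indicator-false (λ t → p≢q (≡ᵇ⇒≡ p q t))) ⟩
  boundary 0 0 f
    ≡⟨ boundary-none f ⟩
  0 ∎

sumVec-split : ∀ {b v m} {g h k : List (Tree b) → ℕ} →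
  (∀ {f} → IncForest v f → g f ≡ h f + k f) →
  (bs : Vec (List (Tree b)) m) → IncBundles v bs → sumVec g bs ≡ sumVec h bs + sumVec k bs
sumVec-split split [] _ = refl
sumVec-split {g = g} {h} {k} split (f ∷ bs) (inc , incs) =
  trans (cong₂ _+_ (split inc) (sumVec-split split bs incs)) (interchange (h f) (k f) _ _)

vertexBundles-eq : ∀ {b m} v (bs : Vec (List (Tree b)) m) → IncBundles v bs →
  Unique (labelsBundles bs) → sumVec (bundleCount Eq v v) bs ≡ sumVec emptyℕ bs
vertexBundles-eq v [] _ _ = refl
vertexBundles-eq v (f ∷ bs) (inc , incs) u =
  cong₂ _+_ (vertexBundle-eq v f inc (unique-++ˡ (labelsForest f) u))
            (vertexBundles-eq v bs incs (unique-++ʳ (labelsForest f) u))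

Weight : ℕ → Set
Weight b = ℕ → Vec (List (Tree b)) b → ℕ

module _ {b : ℕ} where

  mutual
    sumT-+ : ∀ (g h : Weight b) t → sumT (λ v bs → g v bs + h v bs) t ≡ sumT g t + sumT h t
    sumT-+ g h (node v bs) =
      trans (cong (g v bs + h v bs +_) (sumBundles-+ g h bs)) (interchange (g v bs) _ _ _)

    sumBundles-+ : ∀ (g h : Weight b) {m} (bs : Vec (List (Tree b)) m) →
      sumBundles (λ v bs → g v bs + h v bs) bs ≡ sumBundles g bs + sumBundles h bs
    sumBundles-+ g h [] = refl
    sumBundles-+ g h (f ∷ bs) =
      trans (cong₂ _+_ (sumForest-+ g h f) (sumBundles-+ g h bs)) (interchange (sumForest g f) _ _ _)

    sumForest-+ : ∀ (g h : Weight b) (ts : List (Tree b)) →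
      sumForest (λ v bs → g v bs + h v bs) ts ≡ sumForest g ts + sumForest h ts
    sumForest-+ g h [] = refl
    sumForest-+ g h (t ∷ ts) =
      trans (cong₂ _+_ (sumT-+ g h t) (sumForest-+ g h ts)) (interchange (sumT g t) _ _ _)

  module _ (g h : Weight b)
    (agree : ∀ v bs → 1 < v → IncBundles v bs → Unique (labelsBundles bs) → g v bs ≡ h v bs) where

    mutual
      sumT-agree : ∀ t → 1 < label t → Increasing t → Unique (labels t) → sumT g t ≡ sumT h t
      sumT-agree (node v bs) 1<v inc (_ ∷ u) =
        cong₂ _+_ (agree v bs 1<v inc u) (sumBundles-agree v bs (<⇒≤ 1<v) inc u)

      sumBundles-agree : ∀ v {m} (bs : Vec (List (Tree b)) m) → 1 ≤ v → IncBundles v bs →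
        Unique (labelsBundles bs) → sumBundles g bs ≡ sumBundles h bs
      sumBundles-agree v [] _ _ _ = refl
      sumBundles-agree v (f ∷ bs) 1≤v (inc , incs) u =
        cong₂ _+_ (sumForest-agree v f 1≤v inc (unique-++ˡ (labelsForest f) u))
                  (sumBundles-agree v bs 1≤v incs (unique-++ʳ (labelsForest f) u))

      sumForest-agree : ∀ v (ts : List (Tree b)) → 1 ≤ v → IncForest v ts →
        Unique (labelsForest ts) → sumForest g ts ≡ sumForest h ts
      sumForest-agree v [] _ _ _ = refl
      sumForest-agree v (t ∷ ts) 1≤v (v<t , inc , incs) u =
        cong₂ _+_ (sumT-agree t (≤-trans (s≤s 1≤v) v<t) inc (unique-++ˡ (labels t) u))
                  (sumForest-agree v ts 1≤v incs (unique-++ʳ (labels t) u))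

pad-zeros : ∀ a c → a + c ≡ (a + 0) + (c + 0)
pad-zeros = solve-∀

pad-zeros-last : ∀ a c e → a + (c + e) ≡ ((a + 0) + (c + 0)) + e
pad-zeros-last = solve-∀

interchange-last : ∀ a c A C e → (a + c) + ((A + C) + e) ≡ ((a + A) + (c + C)) + e
interchange-last = solve-∀

tail-asc : ∀ {b m} (bs : Vec (List (Tree b)) (suc m)) → IncBundles 1 bs →
  tailCount Asc bs ≡ sumVec (bundlePairs Asc) bs + sumVec nonEmptyℕ bs
tail-asc (f ∷ []) (inc , _) =
  trans (lastBundle-asc f inc) (pad-zeros (bundlePairs Asc f) (nonEmptyℕ f))
tail-asc (f ∷ g ∷ gs) (inc , incs) =
  trans (cong₂ _+_ (vertexBundle-asc 1 inc) (tail-asc (g ∷ gs) incs))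
        (interchange (bundlePairs Asc f) _ _ _)

tail-des : ∀ {b m} (bs : Vec (List (Tree b)) (suc m)) → IncBundles 1 bs →
  tailCount Des bs ≡ (sumVec (bundlePairs Des) bs + sumVec nonEmptyℕ bs) + emptyℕ (last bs)
tail-des (f ∷ []) (inc , _) =
  trans (lastBundle-des f inc) (pad-zeros-last (bundlePairs Des f) (nonEmptyℕ f) (emptyℕ f))
tail-des (f ∷ g ∷ gs) (inc , incs) =
  trans (cong₂ _+_ (vertexBundle-des 1 inc) (tail-des (g ∷ gs) incs))
        (interchange-last (bundlePairs Des f) _ _ _ _)

tail-eq : ∀ {b m} (bs : Vec (List (Tree b)) (suc m)) → IncBundles 1 bs → Unique (labelsBundles bs) →
  tailCount Eq bs ≡ sumVec emptyℕ (init bs)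
tail-eq (f ∷ []) (inc , _) u = outerBundle-eq ≤-refl z≤n (λ ()) f inc (unique-++ˡ (labelsForest f) u)
tail-eq (f ∷ g ∷ gs) (inc , incs) u =
  cong₂ _+_ (vertexBundle-eq 1 f inc (unique-++ˡ (labelsForest f) u))
            (tail-eq (g ∷ gs) incs (unique-++ʳ (labelsForest f) u))

pairWeight : ∀ {b} → (ℕ → ℕ → Bool) → Weight b
pairWeight R _ bs = sumVec (bundlePairs R) bs

nonEmptyWeight : ∀ {b} → Weight b
nonEmptyWeight _ bs = sumVec nonEmptyℕ bs

ascentWeight descentWeight : ∀ {b} → Weight b
ascentWeight v bs = pairWeight Asc v bs + nonEmptyWeight v bs
descentWeight v bs = pairWeight Des v bs + nonEmptyWeight v bs

emptyWeight : ∀ {b} → Weight b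
emptyWeight v bs = if 1 <ᵇ v then sumVec emptyℕ bs else 0

rearrange-asc : ∀ a n e A N S → ((a + (n + e)) + (A + N)) + S ≡ (((a + A) + (n + N)) + S) + e
rearrange-asc = solve-∀

rearrange-des : ∀ a n A N e S → ((a + n) + ((A + N) + e)) + S ≡ (((a + A) + (n + N)) + S) + e
rearrange-des = solve-∀

localCount-ascents : ∀ {b} v (bs : Vec (List (Tree b)) b) → 1 < v → IncBundles v bs →
  Unique (labelsBundles bs) → localCount Asc v bs ≡ ascentWeight v bs
localCount-ascents v bs _ inc _ = sumVec-split (vertexBundle-asc v) bs inc

localCount-descents : ∀ {b} v (bs : Vec (List (Tree b)) b) → 1 < v → IncBundles v bs →
  Unique (labelsBundles bs) → localCount Des v bs ≡ descentWeight v bs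
localCount-descents v bs _ inc _ = sumVec-split (vertexBundle-des v) bs inc

localCount-plateaux : ∀ {b} v (bs : Vec (List (Tree b)) b) → 1 < v → IncBundles v bs →
  Unique (labelsBundles bs) → localCount Eq v bs ≡ emptyWeight v bs
localCount-plateaux (suc (suc v)) bs (s≤s (s≤s _)) inc u =
  vertexBundles-eq (suc (suc v)) bs inc u

module _ {k : ℕ} (f : List (Tree (suc (suc k)))) (bs : Vec (List (Tree (suc (suc k)))) (suc k))
         (incF : IncForest 1 f) (incs : IncBundles 1 bs) (u : Unique (labelsBundles (f ∷ bs))) where

  private
    τ : Tree (suc (suc k))
    τ = node 1 (f ∷ bs)

    inc : IncBundles 1 (f ∷ bs)
    inc = incF , incs

  ascents : asc (Ψ τ) ≡ B-A τ
  ascents = begin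
    asc (Ψ τ)
      ≡⟨ Ψ-count Asc f bs ⟩
    (bundleCount Asc 0 1 f + tailCount Asc bs) + sumBundles (localCount Asc) (f ∷ bs)
      ≡⟨ cong₂ _+_ (cong₂ _+_ (firstBundle-asc f incF) (tail-asc bs incs))
                   (sumBundles-agree (localCount Asc) ascentWeight localCount-ascents
                      1 (f ∷ bs) ≤-refl inc u) ⟩
    ((bundlePairs Asc f + (nonEmptyℕ f + emptyℕ f))
      + (sumVec (bundlePairs Asc) bs + sumVec nonEmptyℕ bs))
      + sumBundles ascentWeight (f ∷ bs)
      ≡⟨ rearrange-asc (bundlePairs Asc f) _ _ _ _ _ ⟩
    sumT ascentWeight τ + emptyℕ f
      ≡⟨ cong (_+ emptyℕ f) (sumT-+ (pairWeight Asc) nonEmptyWeight τ) ⟩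
    B-A τ
      ∎

  descents : des (Ψ τ) ≡ B-D τ
  descents = begin
    des (Ψ τ)
      ≡⟨ Ψ-count Des f bs ⟩
    (bundleCount Des 0 1 f + tailCount Des bs) + sumBundles (localCount Des) (f ∷ bs)
      ≡⟨ cong₂ _+_ (cong₂ _+_ (firstBundle-des f incF) (tail-des bs incs))
                   (sumBundles-agree (localCount Des) descentWeight localCount-descents
                      1 (f ∷ bs) ≤-refl inc u) ⟩
    ((bundlePairs Des f + nonEmptyℕ f)
      + ((sumVec (bundlePairs Des) bs + sumVec nonEmptyℕ bs) + emptyℕ (last bs)))
      + sumBundles descentWeight (f ∷ bs)
      ≡⟨ rearrange-des (bundlePairs Des f) _ _ _ _ _ ⟩
    sumT descentWeight τ + emptyℕ (last bs)
      ≡⟨ cong (_+ emptyℕ (last bs)) (sumT-+ (pairWeight Des) nonEmptyWeight τ) ⟩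
    B-D τ
      ∎

  plateaux : plat (Ψ τ) ≡ B-E τ
  plateaux = begin
    plat (Ψ τ)
      ≡⟨ Ψ-count Eq f bs ⟩
    (bundleCount Eq 0 1 f + tailCount Eq bs) + sumBundles (localCount Eq) (f ∷ bs)
      ≡⟨ cong₂ _+_ (cong₂ _+_ (outerBundle-eq z≤n ≤-refl (λ ()) f incF (unique-++ˡ (labelsForest f) u))
                              (tail-eq bs incs (unique-++ʳ (labelsForest f) u)))
                   (sumBundles-agree (localCount Eq) emptyWeight localCount-plateaux
                      1 (f ∷ bs) ≤-refl inc u) ⟩
    sumVec emptyℕ (init bs) + sumBundles emptyWeight (f ∷ bs)
      ≡⟨ +-comm (sumVec emptyℕ (init bs)) _ ⟩
    B-E τ
      ∎

labels-unique : ∀ {b} n (t : Tree b) → labels t ↭ map suc (upTo n) → Unique (labels t)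
labels-unique n t perm =
  Unique-resp-↭ (↭⇒↭ₛ (↭-sym perm)) (Unique.map⁺ suc-injective (Unique.upTo⁺ n))

theorem3p14 : (k n : ℕ) → 1 ≤ k → 1 ≤ n → (τ : Tree (suc k)) →
    IsBundledIncreasingTree k n τ →
    (asc (Ψ τ) ≡ B-A τ) × (des (Ψ τ) ≡ B-D τ) × (plat (Ψ τ) ≡ B-E τ)
theorem3p14 (suc k) n _ _ τ@(node _ (f ∷ bs)) (refl , (incF , incs) , perm)
  with labels-unique n τ perm
... | _ ∷ u = ascents f bs incF incs u , descents f bs incF incs u , plateaux f bs incF incs u
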